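{- Fix an integer $h\ge1$. Then $\triangle^{\star2}=\triangle\star\triangle=\big(n^e_{[m_1,\dots,m_h]}\big)_{m_1\ge\dots\ge m_h\ge1}$; that is, for every partition $(m_1,\dots,m_h)$ of height $h$, the number of espaliers of height $h$ whose plateau volumes are $m_1,\dots,m_h$ equals the number of pairs of partitions $(\lambda,\lambda')$ of height $h$ with $\lambda_i\lambda'_i=m_i$ for all $i$ (the convolution coefficient of $\triangle\star\triangle$ at $(m_1,\dots,m_h)$).
   Context: A partition of height $h$ is a sequence $\lambda_1\ge\dots\ge\lambda_h\ge1$ of integers. $\triangle\in\mathcal T_h$ is the family indexed by $h$-tuples of positive integers with entry $1$ at $(n_1,\dots,n_h)$ when $n_1\ge\dots\ge n_h$ and $0$ otherwise. For families $A=(a_n),B=(b_n)$ indexed by $h$-tuples of positive integers, $(A\star B)_{n_1,\dots,n_h}=\sum a_{m_1,\dots,m_h}b_{p_1,\dots,p_h}$ over positive integers with $n_i=m_ip_i$ for all $i$. An espalier of height $h$ is a set of unit cells of $\mathbb Z^3$ of the form $\bigcup_{a=0}^{h-1}\{a\}\times\{0,\dots,p_a-1\}\times\{0,\dots,q_a-1\}$ with integers $p_0\ge\dots\ge p_{h-1}\ge1$, $q_0\ge\dots\ge q_{h-1}\ge1$; its plateau volumes are $p_0q_0\ge\dots\ge p_{h-1}q_{h-1}$ (bottom to top). $n^e_{[m_1,\dots,m_h]}$ denotes the number of espaliers of height $h$ whose $i$-th plateau has volume $m_i$ for $i=1,\dots,h$. -}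

module Defs where

open import Data.Nat using (ℕ; zero; suc; _+_; _*_; _≤_; _≥_; _≤ᵇ_; _≡ᵇ_)
open import Data.Bool using (Bool; true; false; _∧_; if_then_else_)
open import Data.List using (List; []; _∷_; map; concatMap; upTo)
open import Data.Nat.ListAction using (sum)
open import Data.Vec using (Vec; []; _∷_; zipWith; toList)
open import Data.List.Relation.Unary.All using (All)
open import Data.List.Relation.Unary.Linked using (Linked)

-- h-tuples of (positive) integers are represented as Vec ℕ h.
-- A family indexed by h-tuples of positive integers: Vec ℕ h → ℕ
-- (values at tuples with a zero entry are irrelevant).
Family : ℕ → Set
Family h = Vec ℕ h → ℕ

IsPartition : ∀ {h} → Vec ℕ h → Set
IsPartition v = Linked _≥_ (toList v) Data.Product.× All (1 ≤_) (toList v)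
  where import Data.Product

nonincᵇ : ∀ {h} → Vec ℕ h → Bool
nonincᵇ [] = true
nonincᵇ (x ∷ []) = true
nonincᵇ (x ∷ y ∷ r) = (y ≤ᵇ x) ∧ nonincᵇ (y ∷ r)

△ : ∀ {h} → Family h
△ n = if nonincᵇ n then 1 else 0

box : ∀ {h} → Vec ℕ h → List (Vec ℕ h)
box [] = [] ∷ []
box (n ∷ ns) = concatMap (λ k → map (k ∷_) (box ns)) (map suc (upTo n))

factorsᵇ : ∀ {h} → Vec ℕ h → Vec ℕ h → Vec ℕ h → Bool
factorsᵇ [] [] [] = true
factorsᵇ (m ∷ ms) (p ∷ ps) (n ∷ ns) = ((m * p) ≡ᵇ n) ∧ factorsᵇ ms ps ns

-- Dirichlet-type convolution: (A ⋆ B)ₙ = Σ_{mᵢ pᵢ = nᵢ} a_m b_p.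
-- For positive nᵢ, every factorisation has 1 ≤ mᵢ, pᵢ ≤ nᵢ, so summing
-- over box n × box n is exactly the sum over all factorisations.
_⋆_ : ∀ {h} → Family h → Family h → Family h
(A ⋆ B) n = sum (concatMap (λ m → map (λ p → if factorsᵇ m p n then A m * B p else 0) (box n)) (box n))

-- An espalier of height h is the cell set
--   ⋃_{a<h} {a} × {0..p_a-1} × {0..q_a-1}
-- with p, q partitions of height h; the cell set determines (p, q) uniquely
-- and vice versa, so an espalier is represented by its parameters.
record Espalier (h : ℕ) : Set where
  constructor espalier
  field
    p : Vec ℕ h
    q : Vec ℕ h
    p-part : IsPartition p
    q-part : IsPartition q

plateauVolumes : ∀ {h} → Espalier h → Vec ℕ h
plateauVolumes E = zipWith _*_ (Espalier.p E) (Espalier.q E)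

Cell : ∀ {h} → Espalier h → ℕ → ℕ → ℕ → Set
Cell {h} E a x y = Data.Product.Σ (Data.Fin.Fin h) (λ i →
    (Data.Fin.toℕ i Relation.Binary.PropositionalEquality.≡ a) Data.Product.×
    (suc x ≤ Data.Vec.lookup (Espalier.p E) i) Data.Product.×
    (suc y ≤ Data.Vec.lookup (Espalier.q E) i))
  where
  import Data.Product
  import Data.Fin
  import Data.Vec
  import Relation.Binary.PropositionalEquality

EspaliersWithVolumes : ∀ h → Vec ℕ h → Set
EspaliersWithVolumes h m = Data.Product.Σ (Espalier h) (λ E → plateauVolumes E Relation.Binary.PropositionalEquality.≡ m)
  where
  import Data.Product
  import Relation.Binary.PropositionalEquality

module Submission where

-- An espalier of height h is determined by two partitions p, q of height h,
-- and its plateau volumes are the pointwise products pᵢqᵢ.  Hence espaliers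
-- with plateau volumes m are the factorisations m = p · q into two
-- partitions, and these are exactly what the convolution (△ ⋆ △) m counts:
-- its sum ranges over pairs (a, b) of integer points of the box
-- [1, m₁] × ⋯ × [1, m_h], and the summand is 1 precisely when a · b = m and
-- a, b are weakly decreasing, and 0 otherwise.

open import Defs
open import Data.Nat using (ℕ; _≤_)
open import Data.Vec using (Vec)
open import Data.Fin using (Fin)
open import Function.Bundles using (_↔_)

open import Data.Nat using (zero; suc; _+_; _*_; _≥_; z≤n; s≤s; _≟_)
open import Data.Nat.Properties using (≡ᵇ⇒≡; ≡⇒≡ᵇ; ≤ᵇ⇒≤; ≤⇒≤ᵇ; ≤-irrelevant; m≤m*n; *-comm)
open import Data.Nat.ListAction using (sum)
open import Data.Bool using (Bool; true; false; T; if_then_else_)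
open import Data.Bool.Properties using (T-∧; T-irrelevant)
open import Data.Unit using (⊤; tt)
open import Data.Sum using (_⊎_; inj₁; inj₂)
open import Data.Product using (Σ; _×_; _,_; proj₁; proj₂)
open import Data.List using (List; []; _∷_; map; concat; applyUpTo; upTo)
open import Data.List.Relation.Unary.Any using (Any)
open import Data.List.Relation.Unary.Any.Properties using (∷↔; ⊥↔Any[]; pure↔; map↔; concat↔)
open import Data.List.Relation.Unary.All as All using (All; []; _∷_)
open import Data.List.Relation.Unary.Linked as Linked using (Linked; []; [-]; _∷_)
open import Data.Vec using ([]; _∷_; zipWith; toList)
open import Data.Vec.Properties using (zipWith-comm; ≡-dec)
open import Data.Fin using (zero; suc; toℕ; fromℕ<)
open import Data.Fin.Properties using (+↔⊎; *↔×; 0↔⊥; toℕ<n; fromℕ<-toℕ; toℕ-fromℕ<)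
open import Data.Sum.Function.Propositional using (_⊎-↔_)
open import Data.Product.Function.NonDependent.Propositional using (_×-↔_)
open import Data.Product.Function.Dependent.Propositional using (Σ-↔)
open import Function using (_∘_; id)
open import Function.Bundles using (mk↔ₛ′; Equivalence)
open import Function.Properties.Inverse using (↔-refl; ↔-sym; ↔-trans)
open import Function.Related.Propositional using (module EquationalReasoning)
open import Function.Related.TypeIsomorphisms using (Σ-assoc)
open import Relation.Nullary.Irrelevant using (Irrelevant)
open import Relation.Binary.PropositionalEquality using (_≡_; refl; cong; cong₂; trans)
open import Axiom.UniquenessOfIdentityProofs using (module Decidable⇒UIP)

open EquationalReasoning

props↔ : {A B : Set} → Irrelevant A → Irrelevant B → (A → B) → (B → A) → A ↔ B
props↔ irrA irrB f g = mk↔ₛ′ f g (λ b → irrB (f (g b)) b) (λ a → irrA (g (f a)) a)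

×-irrelevant : {A B : Set} → Irrelevant A → Irrelevant B → Irrelevant (A × B)
×-irrelevant irrA irrB (a , b) (a′ , b′) = cong₂ _,_ (irrA a a′) (irrB b b′)

subtype-≡ : {A : Set} {P : A → Set} → (∀ x → Irrelevant (P x)) →
            {u v : Σ A P} → proj₁ u ≡ proj₁ v → u ≡ v
subtype-≡ irr {x , px} {.x , px′} refl = cong (x ,_) (irr x px px′)

Σ-Fin-suc↔ : ∀ {k} (P : Fin (suc k) → Set) → (P zero ⊎ Σ (Fin k) (P ∘ suc)) ↔ Σ (Fin (suc k)) P
Σ-Fin-suc↔ P = mk↔ₛ′ to from to∘from from∘to
  where
  to : (P zero ⊎ Σ _ (P ∘ suc)) → Σ _ P
  to (inj₁ x)       = zero , x
  to (inj₂ (t , x)) = suc t , x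
  from : Σ _ P → (P zero ⊎ Σ _ (P ∘ suc))
  from (zero  , x) = inj₁ x
  from (suc t , x) = inj₂ (t , x)
  to∘from : ∀ y → to (from y) ≡ y
  to∘from (zero  , x) = refl
  to∘from (suc t , x) = refl
  from∘to : ∀ y → from (to y) ≡ y
  from∘to (inj₁ x)       = refl
  from∘to (inj₂ (t , x)) = refl

×-Σ↔ : {A B : Set} {C : B → Set} → (A × Σ B C) ↔ Σ B (λ b → A × C b)
×-Σ↔ = mk↔ₛ′ (λ (a , b , c) → b , a , c) (λ (b , a , c) → a , b , c) (λ _ → refl) (λ _ → refl)

Fin-sum↔Any : (ns : List ℕ) → Fin (sum ns) ↔ Any Fin ns
Fin-sum↔Any []       = ↔-trans 0↔⊥ ⊥↔Any[]
Fin-sum↔Any (n ∷ ns) = begin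
  Fin (n + sum ns)        ↔⟨ +↔⊎ ⟩
  (Fin n ⊎ Fin (sum ns))  ↔⟨ ↔-refl ⊎-↔ Fin-sum↔Any ns ⟩
  (Fin n ⊎ Any Fin ns)    ↔⟨ ∷↔ Fin ⟩
  Any Fin (n ∷ ns)        ∎

Any-applyUpTo↔ : {A : Set} (P : A → Set) (f : ℕ → A) (k : ℕ) →
                 Any P (applyUpTo f k) ↔ Σ (Fin k) (λ t → P (f (toℕ t)))
Any-applyUpTo↔ P f zero    = mk↔ₛ′ (λ ()) (λ ()) (λ ()) (λ ())
Any-applyUpTo↔ P f (suc k) = begin
  Any P (f 0 ∷ applyUpTo (f ∘ suc) k)                  ↔⟨ ↔-sym (∷↔ P) ⟩
  (P (f 0) ⊎ Any P (applyUpTo (f ∘ suc) k))            ↔⟨ ↔-refl ⊎-↔ Any-applyUpTo↔ P (f ∘ suc) k ⟩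
  (P (f 0) ⊎ Σ (Fin k) (λ t → P (f (suc (toℕ t)))))    ↔⟨ Σ-Fin-suc↔ (λ t → P (f (toℕ t))) ⟩
  Σ (Fin (suc k)) (λ t → P (f (toℕ t)))                ∎

-- The points of [1, n₁] × ⋯ × [1, n_h], with coordinates shifted to Fin.
Box : ∀ {h} → Vec ℕ h → Set
Box []      = ⊤
Box (k ∷ n) = Fin k × Box n

val : ∀ {h} {n : Vec ℕ h} → Box n → Vec ℕ h
val {n = []}    _       = []
val {n = k ∷ n} (t , b) = suc (toℕ t) ∷ val b

Any-box↔ : ∀ {h} (P : Vec ℕ h → Set) (n : Vec ℕ h) → Any P (box n) ↔ Σ (Box n) (P ∘ val)
Any-box↔ P []      = ↔-trans (↔-sym pure↔) (mk↔ₛ′ (tt ,_) proj₂ (λ _ → refl) (λ _ → refl))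
Any-box↔ P (k ∷ n) = begin
  Any P (concat (map row (map suc (upTo k))))             ↔⟨ ↔-sym concat↔ ⟩
  Any (Any P) (map row (map suc (upTo k)))                ↔⟨ ↔-sym map↔ ⟩
  Any (Any P ∘ row) (map suc (upTo k))                    ↔⟨ ↔-sym map↔ ⟩
  Any (Any P ∘ row ∘ suc) (upTo k)                        ↔⟨ Any-applyUpTo↔ (Any P ∘ row ∘ suc) id k ⟩
  Σ (Fin k) (λ t → Any P (row (suc (toℕ t))))             ↔⟨ Σ-↔ ↔-refl (↔-trans (↔-sym map↔) (Any-box↔ _ n)) ⟩
  Σ (Fin k) (λ t → Σ (Box n) (λ b → P (suc (toℕ t) ∷ val b)))  ↔⟨ ↔-sym Σ-assoc ⟩
  Σ (Box (k ∷ n)) (P ∘ val)                               ∎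
  where
  row : ℕ → List (Vec ℕ _)
  row x = map (x ∷_) (box n)

Fin-if↔ : (b : Bool) (n : ℕ) → Fin (if b then n else 0) ↔ (T b × Fin n)
Fin-if↔ true  n = mk↔ₛ′ (tt ,_) proj₂ (λ _ → refl) (λ _ → refl)
Fin-if↔ false n = mk↔ₛ′ (λ ()) (λ ()) (λ ()) (λ ())

Fin-△↔ : ∀ {h} (v : Vec ℕ h) → Fin (△ v) ↔ T (nonincᵇ v)
Fin-△↔ v = ↔-trans (Fin-if↔ (nonincᵇ v) 1) (mk↔ₛ′ proj₁ (_, zero) (λ _ → refl) λ { (_ , zero) → refl })

Admissible : ∀ {h} → Vec ℕ h → Vec ℕ h → Vec ℕ h → Set
Admissible m a p = T (factorsᵇ a p m) × T (nonincᵇ a) × T (nonincᵇ p)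

summand↔ : ∀ {h} (m a p : Vec ℕ h) →
           Fin (if factorsᵇ a p m then △ a * △ p else 0) ↔ Admissible m a p
summand↔ m a p = ↔-trans (Fin-if↔ (factorsᵇ a p m) (△ a * △ p))
                         (↔-refl ×-↔ ↔-trans *↔× (Fin-△↔ a ×-↔ Fin-△↔ p))

convolution↔ : ∀ {h} (m : Vec ℕ h) →
  Fin ((△ ⋆ △) m) ↔ Σ (Box m) (λ a → Σ (Box m) (λ b → Admissible m (val a) (val b)))
convolution↔ m = begin
  Fin (sum (concat (map row (box m))))                         ↔⟨ Fin-sum↔Any _ ⟩
  Any Fin (concat (map row (box m)))                           ↔⟨ ↔-sym concat↔ ⟩
  Any (Any Fin) (map row (box m))                              ↔⟨ ↔-sym map↔ ⟩
  Any (Any Fin ∘ row) (box m)                                  ↔⟨ Any-box↔ _ m ⟩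
  Σ (Box m) (λ a → Any Fin (row (val a)))                      ↔⟨ Σ-↔ ↔-refl (↔-trans (↔-sym map↔) (Any-box↔ _ m)) ⟩
  Σ (Box m) (λ a → Σ (Box m) (λ b → Fin (c (val a) (val b))))  ↔⟨ Σ-↔ ↔-refl (λ {a} → Σ-↔ ↔-refl (λ {b} → summand↔ m (val a) (val b))) ⟩
  Σ (Box m) (λ a → Σ (Box m) (λ b → Admissible m (val a) (val b)))  ∎
  where
  c : Vec ℕ _ → Vec ℕ _ → ℕ
  c a p = if factorsᵇ a p m then △ a * △ p else 0
  row : Vec ℕ _ → List ℕ
  row a = map (c a) (box m)

InBox : ∀ {h} → Vec ℕ h → Vec ℕ h → Set
InBox []      []      = ⊤
InBox (x ∷ v) (k ∷ n) = (1 ≤ x × x ≤ k) × InBox v n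

InBox-irrelevant : ∀ {h} (v n : Vec ℕ h) → Irrelevant (InBox v n)
InBox-irrelevant []      []      _ _ = refl
InBox-irrelevant (x ∷ v) (k ∷ n) =
  ×-irrelevant (×-irrelevant ≤-irrelevant ≤-irrelevant) (InBox-irrelevant v n)

val-inBox : ∀ {h} {n : Vec ℕ h} (b : Box n) → InBox (val b) n
val-inBox {n = []}    _       = tt
val-inBox {n = k ∷ n} (t , b) = (s≤s z≤n , toℕ<n t) , val-inBox b

toBox : ∀ {h} {n : Vec ℕ h} (v : Vec ℕ h) → InBox v n → Box n
toBox {n = []}    []          _                         = tt
toBox {n = k ∷ n} (suc x ∷ v) ((s≤s z≤n , x<k) , inBox) = fromℕ< x<k , toBox v inBox

val-toBox : ∀ {h} {n : Vec ℕ h} (v : Vec ℕ h) (inBox : InBox v n) → val (toBox v inBox) ≡ v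
val-toBox {n = []}    []          _                         = refl
val-toBox {n = k ∷ n} (suc x ∷ v) ((s≤s z≤n , x<k) , inBox) =
  cong₂ _∷_ (cong suc (toℕ-fromℕ< x<k)) (val-toBox v inBox)

toBox-val : ∀ {h} {n : Vec ℕ h} (b : Box n) (inBox : InBox (val b) n) → toBox (val b) inBox ≡ b
toBox-val {n = []}    _       _                         = refl
toBox-val {n = k ∷ n} (t , b) ((s≤s z≤n , t<k) , inBox) =
  cong₂ _,_ (fromℕ<-toℕ t t<k) (toBox-val b inBox)

Box↔InBox : ∀ {h} (n : Vec ℕ h) → Box n ↔ Σ (Vec ℕ h) (λ v → InBox v n)
Box↔InBox n = mk↔ₛ′ (λ b → val b , val-inBox b) (λ (v , inBox) → toBox v inBox)
  (λ (v , inBox) → subtype-≡ (λ v → InBox-irrelevant v n) (val-toBox v inBox))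
  (λ b → toBox-val b (val-inBox b))

Σ-Box↔ : ∀ {h} (n : Vec ℕ h) (P : Vec ℕ h → Set) →
         Σ (Box n) (P ∘ val) ↔ Σ (Vec ℕ h) (λ v → InBox v n × P v)
Σ-Box↔ n P = ↔-trans (Σ-↔ (Box↔InBox n) ↔-refl) Σ-assoc

nonincᵇ-sound : ∀ {h} (v : Vec ℕ h) → T (nonincᵇ v) → Linked _≥_ (toList v)
nonincᵇ-sound []          _ = []
nonincᵇ-sound (x ∷ [])    _ = [-]
nonincᵇ-sound (x ∷ y ∷ v) t =
  ≤ᵇ⇒≤ y x (proj₁ (Equivalence.to T-∧ t))
    ∷ nonincᵇ-sound (y ∷ v) (proj₂ (Equivalence.to T-∧ t))

nonincᵇ-complete : ∀ {h} (v : Vec ℕ h) → Linked _≥_ (toList v) → T (nonincᵇ v)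
nonincᵇ-complete []          _            = tt
nonincᵇ-complete (x ∷ [])    _            = tt
nonincᵇ-complete (x ∷ y ∷ v) (y≤x ∷ rest) =
  Equivalence.from T-∧ (≤⇒≤ᵇ y≤x , nonincᵇ-complete (y ∷ v) rest)

factorsᵇ-sound : ∀ {h} (a p m : Vec ℕ h) → T (factorsᵇ a p m) → zipWith _*_ a p ≡ m
factorsᵇ-sound []      []      []      _ = refl
factorsᵇ-sound (x ∷ a) (y ∷ p) (z ∷ m) t =
  cong₂ _∷_ (≡ᵇ⇒≡ (x * y) z (proj₁ (Equivalence.to T-∧ t)))
            (factorsᵇ-sound a p m (proj₂ (Equivalence.to T-∧ t)))

factorsᵇ-complete : ∀ {h} (a p m : Vec ℕ h) → zipWith _*_ a p ≡ m → T (factorsᵇ a p m)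
factorsᵇ-complete []      []      []                             _    = tt
factorsᵇ-complete (x ∷ a) (y ∷ p) (.(x * y) ∷ .(zipWith _*_ a p)) refl =
  Equivalence.from T-∧ (≡⇒≡ᵇ (x * y) (x * y) refl , factorsᵇ-complete a p _ refl)

Factorisation : ∀ {h} → Vec ℕ h → Vec ℕ h → Vec ℕ h → Set
Factorisation m p q = IsPartition p × IsPartition q × zipWith _*_ p q ≡ m

IsPartition-irrelevant : ∀ {h} (v : Vec ℕ h) → Irrelevant (IsPartition v)
IsPartition-irrelevant v = ×-irrelevant (Linked.irrelevant ≤-irrelevant) (All.irrelevant ≤-irrelevant)

Factorisation-irrelevant : ∀ {h} (m p q : Vec ℕ h) → Irrelevant (Factorisation m p q)
Factorisation-irrelevant m p q =
  ×-irrelevant (IsPartition-irrelevant p)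
    (×-irrelevant (IsPartition-irrelevant q) (Decidable⇒UIP.≡-irrelevant (≡-dec _≟_)))

Admissible-irrelevant : ∀ {h} (m a p : Vec ℕ h) → Irrelevant (Admissible m a p)
Admissible-irrelevant m a p = ×-irrelevant T-irrelevant (×-irrelevant T-irrelevant T-irrelevant)

inBox⇒positive : ∀ {h} {n : Vec ℕ h} (v : Vec ℕ h) → InBox v n → All (1 ≤_) (toList v)
inBox⇒positive {n = []}    []      _                = []
inBox⇒positive {n = k ∷ n} (x ∷ v) ((1≤x , _) , i) = 1≤x ∷ inBox⇒positive v i

factor-inBox : ∀ {h} (p q m : Vec ℕ h) → All (1 ≤_) (toList p) → All (1 ≤_) (toList q) →
               zipWith _*_ p q ≡ m → InBox p m
factor-inBox []      []      []                              _          _              _    = tt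
factor-inBox (x ∷ p) (y ∷ q) (.(x * y) ∷ .(zipWith _*_ p q)) (1≤x ∷ ps) (s≤s z≤n ∷ qs) refl =
  (1≤x , m≤m*n x y) , factor-inBox p q _ ps qs refl

admissible↔factorisation : ∀ {h} (m p q : Vec ℕ h) →
  (InBox p m × InBox q m × Admissible m p q) ↔ Factorisation m p q
admissible↔factorisation m p q =
  props↔ (×-irrelevant (InBox-irrelevant p m)
            (×-irrelevant (InBox-irrelevant q m) (Admissible-irrelevant m p q)))
         (Factorisation-irrelevant m p q) sound complete
  where
  sound : InBox p m × InBox q m × Admissible m p q → Factorisation m p q
  sound (p∈m , q∈m , pq≡m , p↓ , q↓) =
    (nonincᵇ-sound p p↓ , inBox⇒positive p p∈m) , (nonincᵇ-sound q q↓ , inBox⇒positive q q∈m) ,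
    factorsᵇ-sound p q m pq≡m
  complete : Factorisation m p q → InBox p m × InBox q m × Admissible m p q
  complete ((p↓ , p>0) , (q↓ , q>0) , pq≡m) =
    factor-inBox p q m p>0 q>0 pq≡m , factor-inBox q p m q>0 p>0 (trans (zipWith-comm *-comm q p) pq≡m) ,
    factorsᵇ-complete p q m pq≡m , nonincᵇ-complete p p↓ , nonincᵇ-complete q q↓

admissiblePairs↔factorisations : ∀ {h} (m : Vec ℕ h) →
  Σ (Box m) (λ a → Σ (Box m) (λ b → Admissible m (val a) (val b))) ↔
  Σ (Vec ℕ h) (λ p → Σ (Vec ℕ h) (λ q → Factorisation m p q))
admissiblePairs↔factorisations {h} m = begin
  Σ (Box m) (λ a → Σ (Box m) (λ b → Admissible m (val a) (val b)))   ↔⟨ Σ-Box↔ m _ ⟩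
  Σ (Vec ℕ h) (λ p → InBox p m × Σ (Box m) (λ b → Admissible m p (val b)))
    ↔⟨ Σ-↔ ↔-refl (↔-refl ×-↔ Σ-Box↔ m _) ⟩
  Σ (Vec ℕ h) (λ p → InBox p m × Σ (Vec ℕ h) (λ q → InBox q m × Admissible m p q))
    ↔⟨ Σ-↔ ↔-refl ×-Σ↔ ⟩
  Σ (Vec ℕ h) (λ p → Σ (Vec ℕ h) (λ q → InBox p m × InBox q m × Admissible m p q))
    ↔⟨ Σ-↔ ↔-refl (λ {p} → Σ-↔ ↔-refl (λ {q} → admissible↔factorisation m p q)) ⟩
  Σ (Vec ℕ h) (λ p → Σ (Vec ℕ h) (λ q → Factorisation m p q))        ∎

espaliers↔factorisations : ∀ {h} (m : Vec ℕ h) →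
  EspaliersWithVolumes h m ↔ Σ (Vec ℕ h) (λ p → Σ (Vec ℕ h) (λ q → Factorisation m p q))
espaliers↔factorisations m = mk↔ₛ′
  (λ (espalier p q p-part q-part , pq≡m) → p , q , p-part , q-part , pq≡m)
  (λ (p , q , p-part , q-part , pq≡m) → espalier p q p-part q-part , pq≡m)
  (λ _ → refl) (λ _ → refl)

-- The theorem: △ ⋆ △ counts espaliers by plateau volumes.
lemma2 : (h : ℕ) → 1 ≤ h → (m : Vec ℕ h) → IsPartition m →
    EspaliersWithVolumes h m ↔ Fin ((△ ⋆ △) m)
lemma2 h _ m _ = begin
  EspaliersWithVolumes h m                                           ↔⟨ espaliers↔factorisations m ⟩
  Σ (Vec ℕ h) (λ p → Σ (Vec ℕ h) (λ q → Factorisation m p q))        ↔⟨ ↔-sym (admissiblePairs↔factorisations m) ⟩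
  Σ (Box m) (λ a → Σ (Box m) (λ b → Admissible m (val a) (val b)))   ↔⟨ ↔-sym (convolution↔ m) ⟩
  Fin ((△ ⋆ △) m)                                                    ∎
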